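{- Any triangle-free graph on $n\ge2$ vertices with $m\ge1$ edges and $w_3$ directed three-edge walks contains a bipartite induced subgraph of minimum degree at least $w_3/(4nm)$.
   Context: A directed three-edge walk in a graph is a sequence $(v_0,v_1,v_2,v_3)$ of vertices with $v_{i-1}v_i$ an edge for $i=1,2,3$; equivalently $w_3$ is the sum of all entries of $A^3$, where $A$ is the adjacency matrix. A bipartite induced subgraph is a subgraph induced by a nonempty vertex set which is bipartite. -}

module Defs where

open import Data.Nat using (ℕ; zero; suc; _+_; _*_; _<ᵇ_)
open import Data.Bool using (Bool; true; false; _∧_; if_then_else_)
open import Data.Fin using (Fin; toℕ)
import Data.Fin as F
open import Data.Product using (Σ; _×_; ∃)
open import Relation.Binary.PropositionalEquality using (_≡_; _≢_)
open import Relation.Nullary using (¬_)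

sumFin : ∀ {n} → (Fin n → ℕ) → ℕ
sumFin {zero}  f = 0
sumFin {suc n} f = f F.zero + sumFin (λ i → f (F.suc i))

𝟙 : Bool → ℕ
𝟙 true  = 1
𝟙 false = 0

record Graph (n : ℕ) : Set where
  field
    adj    : Fin n → Fin n → Bool
    sym    : ∀ u v → adj u v ≡ adj v u
    irrefl : ∀ v → adj v v ≡ false
open Graph public

TriangleFree : ∀ {n} → Graph n → Set
TriangleFree G = ∀ u v w → ¬ (adj G u v ≡ true × adj G v w ≡ true × adj G u w ≡ true)

edgeCount : ∀ {n} → Graph n → ℕ
edgeCount G = sumFin λ i → sumFin λ j → 𝟙 ((toℕ i <ᵇ toℕ j) ∧ adj G i j)

walks3 : ∀ {n} → Graph n → ℕ
walks3 G = sumFin λ a → sumFin λ b → sumFin λ c → sumFin λ d →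
  𝟙 (adj G a b) * 𝟙 (adj G b c) * 𝟙 (adj G c d)

Subset : ℕ → Set
Subset n = Fin n → Bool

_∈S_ : ∀ {n} → Fin n → Subset n → Set
v ∈S S = S v ≡ true

Nonempty : ∀ {n} → Subset n → Set
Nonempty S = ∃ λ v → v ∈S S

InducedBipartite : ∀ {n} → Graph n → Subset n → Set
InducedBipartite {n} G S = Σ (Fin n → Bool) λ c →
  ∀ u v → u ∈S S → v ∈S S → adj G u v ≡ true → c u ≢ c v

inducedDeg : ∀ {n} → Graph n → Subset n → Fin n → ℕ
inducedDeg G S v = sumFin λ u → 𝟙 (S u ∧ adj G v u)

-- Grouping the w₃ three-edge walks by their end points (u, w) and using Σ (deg u + deg w) ≤ 4nm,
-- averaging yields a pair u, w with 4nm · walks(u, w) ≥ w₃ · (deg u + deg w). In a triangle-free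
-- graph every walk u x y w has x ∈ N(u) ∖ N(w) and y ∈ N(w) ∖ N(u), so the graph induced on
-- N(u) Δ N(w) is bipartite (colour by adjacency to u), has at most deg u + deg w vertices and at
-- least walks(u, w) edges, i.e. average degree at least 2w₃ / 4nm. Repeatedly deleting vertices of
-- degree below w₃ / 4nm then leaves a nonempty induced subgraph of minimum degree at least w₃ / 4nm.
module Submission where

open import Defs renaming (sym to adj-sym)
open import Data.Nat using (ℕ; zero; suc; _+_; _*_; _≤_; _<_; _<ᵇ_; z≤n; s≤s; s≤s⁻¹; _≤?_; _<?_; >-nonZero; >-nonZero⁻¹)
open import Data.Nat.Properties
open import Data.Bool using (true; false; _∧_; _xor_; not; T)
import Data.Bool as Bool
open import Data.Fin using (Fin; toℕ)
import Data.Fin as F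
open import Data.Fin.Properties using (any?; toℕ-injective)
open import Data.Nat.Tactic.RingSolver using (solve-∀)
open import Data.Product using (Σ; _×_; _,_; ∃; ∃₂; proj₁; proj₂)
open import Function using (_∘_)
open import Relation.Binary.PropositionalEquality
open import Relation.Nullary using (does; yes; no; contradiction)
open import Relation.Nullary.Decidable using (_×-dec_)
open import Algebra.Properties.CommutativeSemigroup +-commutativeSemigroup using (interchange)

sumFin-cong : ∀ {k} {f g : Fin k → ℕ} → (∀ i → f i ≡ g i) → sumFin f ≡ sumFin g
sumFin-cong {zero}  f≗g = refl
sumFin-cong {suc k} f≗g = cong₂ _+_ (f≗g F.zero) (sumFin-cong (f≗g ∘ F.suc))

sumFin-mono-≤ : ∀ {k} {f g : Fin k → ℕ} → (∀ i → f i ≤ g i) → sumFin f ≤ sumFin g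
sumFin-mono-≤ {zero}  f≤g = z≤n
sumFin-mono-≤ {suc k} f≤g = +-mono-≤ (f≤g F.zero) (sumFin-mono-≤ (f≤g ∘ F.suc))

sumFin-mono-< : ∀ {k} {f g : Fin k → ℕ} → (∀ i → f i ≤ g i) → ∀ j → f j < g j → sumFin f < sumFin g
sumFin-mono-< f≤g F.zero    fj<gj = +-mono-<-≤ fj<gj (sumFin-mono-≤ (f≤g ∘ F.suc))
sumFin-mono-< f≤g (F.suc j) fj<gj = +-mono-≤-< (f≤g F.zero) (sumFin-mono-< (f≤g ∘ F.suc) j fj<gj)

sumFin-distrib-+ : ∀ {k} (f g : Fin k → ℕ) → sumFin (λ i → f i + g i) ≡ sumFin f + sumFin g
sumFin-distrib-+ {zero}  f g = refl
sumFin-distrib-+ {suc k} f g = trans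
  (cong (f F.zero + g F.zero +_) (sumFin-distrib-+ (f ∘ F.suc) (g ∘ F.suc)))
  (interchange (f F.zero) (g F.zero) (sumFin (f ∘ F.suc)) (sumFin (g ∘ F.suc)))

sumFin-*ˡ : ∀ {k} c (f : Fin k → ℕ) → sumFin (λ i → c * f i) ≡ c * sumFin f
sumFin-*ˡ {zero}  c f = sym (*-zeroʳ c)
sumFin-*ˡ {suc k} c f = trans (cong (c * f F.zero +_) (sumFin-*ˡ c (f ∘ F.suc)))
  (sym (*-distribˡ-+ c (f F.zero) _))

sumFin-const : ∀ {k} c → sumFin {k} (λ _ → c) ≡ k * c
sumFin-const {zero}  c = refl
sumFin-const {suc k} c = cong (c +_) (sumFin-const {k} c)

sumFin-zero : ∀ {k} → sumFin {k} (λ _ → 0) ≡ 0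
sumFin-zero {k} = trans (sumFin-const {k} 0) (*-zeroʳ k)

sumFin-comm : ∀ {k l} (f : Fin k → Fin l → ℕ) →
  sumFin (λ i → sumFin (f i)) ≡ sumFin (λ j → sumFin (λ i → f i j))
sumFin-comm {zero}  {l} f = sym (sumFin-zero {l})
sumFin-comm {suc k}     f = trans (cong (sumFin (f F.zero) +_) (sumFin-comm (f ∘ F.suc)))
  (sym (sumFin-distrib-+ (f F.zero) (λ j → sumFin (λ i → f (F.suc i) j))))

term≤sumFin : ∀ {k} (f : Fin k → ℕ) i → f i ≤ sumFin f
term≤sumFin f F.zero    = m≤m+n _ _
term≤sumFin f (F.suc i) = ≤-trans (term≤sumFin (f ∘ F.suc) i) (m≤n+m _ _)

sumFin>0⇒term>0 : ∀ {k} (f : Fin k → ℕ) → 0 < sumFin f → ∃ λ i → 0 < f i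
sumFin>0⇒term>0 {suc k} f Σf>0 with 0 <? f F.zero
... | yes f₀>0 = F.zero , f₀>0
... | no  f₀≯0 with sumFin>0⇒term>0 (f ∘ F.suc)
  (subst (λ z → 0 < z + sumFin (f ∘ F.suc)) (n≤0⇒n≡0 (≮⇒≥ f₀≯0)) Σf>0)
...   | i , fi>0 = F.suc i , fi>0

sumFin-δ : ∀ {k} (x : Fin k) (f : Fin k → ℕ) → sumFin (λ y → 𝟙 (does (y F.≟ x)) * f y) ≡ f x
sumFin-δ {suc k} F.zero    f = trans (cong₂ _+_ (+-identityʳ (f F.zero)) (sumFin-zero {k})) (+-identityʳ _)
sumFin-δ {suc k} (F.suc x) f = sumFin-δ x (f ∘ F.suc)

sumFin²-distrib-+ : ∀ {k l} (f g : Fin k → Fin l → ℕ) →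
  sumFin (λ i → sumFin (λ j → f i j + g i j)) ≡ sumFin (λ i → sumFin (f i)) + sumFin (λ i → sumFin (g i))
sumFin²-distrib-+ f g = trans (sumFin-cong (λ i → sumFin-distrib-+ (f i) (g i)))
  (sumFin-distrib-+ (λ i → sumFin (f i)) (λ i → sumFin (g i)))

averaging : ∀ {k} (f g : Fin k → ℕ) {F G : ℕ} → 0 < F → F ≤ sumFin f → sumFin g ≤ G →
  ∃ λ i → F * g i ≤ G * f i × 0 < f i
averaging f g {F} {G} F>0 F≤Σf Σg≤G with any? (λ i → (F * g i ≤? G * f i) ×-dec (0 <? f i))
... | yes heavy = heavy
... | no  none  = contradiction refl (<⇒≢ GF<GF)
  where
  not-heavy : ∀ i → 0 < f i → G * f i < F * g i
  not-heavy i fi>0 = ≰⇒> λ heavy → none (i , heavy , fi>0)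

  light : ∀ i → G * f i ≤ F * g i
  light i with 0 <? f i
  ... | yes fi>0 = <⇒≤ (not-heavy i fi>0)
  ... | no  fi≯0 rewrite n≤0⇒n≡0 (≮⇒≥ fi≯0) | *-zeroʳ G = z≤n

  i₀ = sumFin>0⇒term>0 f (<-≤-trans F>0 F≤Σf)

  GF<GF : G * F < G * F
  GF<GF = begin-strict
    G * F                   ≤⟨ *-monoʳ-≤ G F≤Σf ⟩
    G * sumFin f            ≡⟨ sumFin-*ˡ G f ⟨
    sumFin (λ i → G * f i)  <⟨ sumFin-mono-< light (proj₁ i₀) (not-heavy (proj₁ i₀) (proj₂ i₀)) ⟩
    sumFin (λ i → F * g i)  ≡⟨ sumFin-*ˡ F g ⟩
    F * sumFin g            ≤⟨ *-monoʳ-≤ F Σg≤G ⟩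
    F * G                   ≡⟨ *-comm F G ⟩
    G * F                   ∎
    where open ≤-Reasoning

0<m*n⇒0<n : ∀ m {n} → 0 < m * n → 0 < n
0<m*n⇒0<n m {n} mn>0 = >-nonZero⁻¹ n {{m*n≢0⇒n≢0 m {{>-nonZero mn>0}}}}

cross-≤-trans : ∀ W K {f g s p} → W * g ≤ K * f → f * s ≤ g * p → 0 < f → W * s ≤ K * p
cross-≤-trans W K {f} {g} {s} {p} Wg≤Kf fs≤gp f>0 =
  *-cancelʳ-≤ (W * s) (K * p) f {{>-nonZero f>0}} (begin
    W * s * f    ≡⟨ *-assoc W s f ⟩
    W * (s * f)  ≡⟨ cong (W *_) (*-comm s f) ⟩
    W * (f * s)  ≤⟨ *-monoʳ-≤ W fs≤gp ⟩
    W * (g * p)  ≡⟨ *-assoc W g p ⟨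
    W * g * p    ≤⟨ *-monoˡ-≤ p Wg≤Kf ⟩
    K * f * p    ≡⟨ *-assoc K f p ⟩
    K * (f * p)  ≡⟨ cong (K *_) (*-comm f p) ⟩
    K * (p * f)  ≡⟨ *-assoc K p f ⟨
    K * p * f    ∎)
  where open ≤-Reasoning

𝟙-∧ : ∀ a b → 𝟙 (a ∧ b) ≡ 𝟙 a * 𝟙 b
𝟙-∧ true  b = sym (+-identityʳ (𝟙 b))
𝟙-∧ false b = refl

𝟙-xor-≤ : ∀ a b → 𝟙 (a xor b) ≤ 𝟙 a + 𝟙 b
𝟙-xor-≤ true  true  = z≤n
𝟙-xor-≤ true  false = ≤-refl
𝟙-xor-≤ false b     = ≤-refl

𝟙>0⇒≡true : ∀ {b} → 0 < 𝟙 b → b ≡ true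
𝟙>0⇒≡true {true} _ = refl

𝟙*>0⇒≡true : ∀ b {m} → 0 < 𝟙 b * m → b ≡ true
𝟙*>0⇒≡true true _ = refl

𝟙∧>0⇒≡true : ∀ a b → 0 < 𝟙 (a ∧ b) → b ≡ true
𝟙∧>0⇒≡true true b 0<b = 𝟙>0⇒≡true 0<b

∧≡true⇒ˡ : ∀ {a b} → a ∧ b ≡ true → a ≡ true
∧≡true⇒ˡ {true} _ = refl

deg : ∀ {n} → Graph n → Fin n → ℕ
deg G x = sumFin λ y → 𝟙 (adj G x y)

walksBetween : ∀ {n} → Graph n → Fin n → Fin n → ℕ
walksBetween G u w = sumFin λ x → sumFin λ y → 𝟙 (adj G u x) * 𝟙 (adj G x y) * 𝟙 (adj G y w)

module _ {n} (G : Graph n) where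

  private
    <ᵇ≡false⇒≥ : ∀ {a b} → (a <ᵇ b) ≡ false → b ≤ a
    <ᵇ≡false⇒≥ a≮ᵇb = ≮⇒≥ λ a<b → subst T a≮ᵇb (<⇒<ᵇ a<b)

    𝟙-adj-≤-oriented : ∀ i j →
      𝟙 (adj G i j) ≤ 𝟙 ((toℕ i <ᵇ toℕ j) ∧ adj G i j) + 𝟙 ((toℕ j <ᵇ toℕ i) ∧ adj G j i)
    𝟙-adj-≤-oriented i j with toℕ i <ᵇ toℕ j in i<j | toℕ j <ᵇ toℕ i in j<i
    ... | true  | _     = m≤m+n _ _
    ... | false | true  = ≤-reflexive (cong 𝟙 (adj-sym G i j))
    ... | false | false = ≤-reflexive (cong 𝟙 (subst (λ v → adj G v j ≡ false) (sym i≡j) (irrefl G j)))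
      where
      i≡j : i ≡ j
      i≡j = toℕ-injective (≤-antisym (<ᵇ≡false⇒≥ j<i) (<ᵇ≡false⇒≥ i<j))

  handshake-≤ : sumFin (deg G) ≤ 2 * edgeCount G
  handshake-≤ = begin
      sumFin (deg G)
    ≤⟨ sumFin-mono-≤ (λ i → sumFin-mono-≤ (𝟙-adj-≤-oriented i)) ⟩
      sumFin (λ i → sumFin (λ j → forward i j + backward i j))
    ≡⟨ sumFin²-distrib-+ forward backward ⟩
      edgeCount G + sumFin (λ i → sumFin (backward i))
    ≡⟨ cong (edgeCount G +_) (trans (sumFin-comm backward) (sym (+-identityʳ _))) ⟩
      2 * edgeCount G ∎
    where
    open ≤-Reasoning
    forward backward : Fin n → Fin n → ℕ
    forward  i j = 𝟙 ((toℕ i <ᵇ toℕ j) ∧ adj G i j)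
    backward i j = 𝟙 ((toℕ j <ᵇ toℕ i) ∧ adj G j i)

  degreePairSum-≤ : sumFin (λ u → sumFin λ w → deg G u + deg G w) ≤ 4 * n * edgeCount G
  degreePairSum-≤ = begin
      sumFin (λ u → sumFin λ w → deg G u + deg G w)
    ≡⟨ sumFin-cong (λ u → trans (sumFin-distrib-+ (λ _ → deg G u) (deg G))
                                 (cong (_+ D) (sumFin-const {n} (deg G u)))) ⟩
      sumFin (λ u → n * deg G u + D)
    ≡⟨ trans (sumFin-distrib-+ (λ u → n * deg G u) (λ _ → D))
             (cong₂ _+_ (sumFin-*ˡ n (deg G)) (sumFin-const {n} D)) ⟩
      n * D + n * D
    ≤⟨ +-mono-≤ (*-monoʳ-≤ n handshake-≤) (*-monoʳ-≤ n handshake-≤) ⟩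
      n * (2 * m) + n * (2 * m)
    ≡⟨ quadruple n m ⟩
      4 * n * m ∎
    where
    open ≤-Reasoning
    D = sumFin (deg G)
    m = edgeCount G
    quadruple : ∀ n m → n * (2 * m) + n * (2 * m) ≡ 4 * n * m
    quadruple = solve-∀

  walks3≡sum-walksBetween : walks3 G ≡ sumFin (λ u → sumFin (walksBetween G u))
  walks3≡sum-walksBetween = sumFin-cong λ a →
    trans (sumFin-cong λ b → sumFin-comm (walk a b))
          (sumFin-comm (λ b d → sumFin λ c → walk a b c d))
    where
    walk : Fin n → Fin n → Fin n → Fin n → ℕ
    walk a b c d = 𝟙 (adj G a b) * 𝟙 (adj G b c) * 𝟙 (adj G c d)

  walksBetween-sym : ∀ u w → walksBetween G w u ≡ walksBetween G u w
  walksBetween-sym u w = trans (sumFin-comm (λ x y → 𝟙 (adj G w x) * 𝟙 (adj G x y) * 𝟙 (adj G y u)))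
                               (sumFin-cong λ x → sumFin-cong (reversed x))
    where
    open ≡-Reasoning
    reverse : ∀ a b c → a * b * c ≡ c * b * a
    reverse = solve-∀
    reversed : ∀ x y → 𝟙 (adj G w y) * 𝟙 (adj G y x) * 𝟙 (adj G x u) ≡ 𝟙 (adj G u x) * 𝟙 (adj G x y) * 𝟙 (adj G y w)
    reversed x y = begin
        𝟙 (adj G w y) * 𝟙 (adj G y x) * 𝟙 (adj G x u)
      ≡⟨ reverse (𝟙 (adj G w y)) (𝟙 (adj G y x)) (𝟙 (adj G x u)) ⟩
        𝟙 (adj G x u) * 𝟙 (adj G y x) * 𝟙 (adj G w y)
      ≡⟨ cong₂ _*_ (cong₂ _*_ (cong 𝟙 (adj-sym G x u)) (cong 𝟙 (adj-sym G y x))) (cong 𝟙 (adj-sym G w y)) ⟩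
        𝟙 (adj G u x) * 𝟙 (adj G x y) * 𝟙 (adj G y w) ∎

  edgeCount>0⇒edge : 1 ≤ edgeCount G → ∃₂ λ i j → adj G i j ≡ true
  edgeCount>0⇒edge m>0 with sumFin>0⇒term>0 _ m>0
  ... | i , i-edges>0 with sumFin>0⇒term>0 _ i-edges>0
  ...   | j , ij>0 = i , j , 𝟙∧>0⇒≡true (toℕ i <ᵇ toℕ j) (adj G i j) ij>0

  walks3>0 : 1 ≤ edgeCount G → 0 < walks3 G
  walks3>0 m>0 with edgeCount>0⇒edge m>0
  ... | i , j , i~j = begin-strict
      0                          <⟨ back-and-forth ⟩
      walk i j i j               ≤⟨ term≤sumFin (walk i j i) j ⟩
      sumFin (walk i j i)        ≤⟨ term≤sumFin (λ c → sumFin (walk i j c)) i ⟩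
      sumFin (λ c → sumFin (walk i j c))
        ≤⟨ term≤sumFin (λ b → sumFin λ c → sumFin (walk i b c)) j ⟩
      sumFin (λ b → sumFin λ c → sumFin (walk i b c))
        ≤⟨ term≤sumFin (λ a → sumFin λ b → sumFin λ c → sumFin (walk a b c)) i ⟩
      walks3 G                   ∎
    where
    open ≤-Reasoning
    walk : Fin n → Fin n → Fin n → Fin n → ℕ
    walk a b c d = 𝟙 (adj G a b) * 𝟙 (adj G b c) * 𝟙 (adj G c d)
    back-and-forth : 0 < walk i j i j
    back-and-forth rewrite i~j | adj-sym G j i | i~j = s≤s z≤n

  ∃-heavy-pair : 0 < walks3 G → ∃₂ λ u w →
    walks3 G * (deg G u + deg G w) ≤ 4 * n * edgeCount G * walksBetween G u w × 0 < walksBetween G u w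
  ∃-heavy-pair W>0
    with averaging (λ u → sumFin (walksBetween G u)) (λ u → sumFin λ w → deg G u + deg G w)
                   W>0 (≤-reflexive walks3≡sum-walksBetween) degreePairSum-≤
  ... | u , Wg≤Kf , f>0 with averaging (walksBetween G u) (λ w → deg G u + deg G w) f>0 ≤-refl ≤-refl
  ...   | w , fs≤gp , p>0 = u , w , cross-≤-trans (walks3 G) (4 * n * edgeCount G) Wg≤Kf fs≤gp f>0 , p>0

_⊆S_ : ∀ {n} → Subset n → Subset n → Set
S ⊆S T = ∀ v → v ∈S S → v ∈S T

size : ∀ {n} → Subset n → ℕ
size T = sumFin λ x → 𝟙 (T x)

remove : ∀ {n} → Subset n → Fin n → Subset n
remove T x y = T y ∧ not (does (y F.≟ x))

𝟙-remove-count : ∀ t e → 𝟙 t ≡ 𝟙 (t ∧ not e) + 𝟙 e * 𝟙 t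
𝟙-remove-count true  true  = refl
𝟙-remove-count true  false = refl
𝟙-remove-count false e     = sym (*-zeroʳ (𝟙 e))

size-remove : ∀ {n} (T : Subset n) x → x ∈S T → size T ≡ suc (size (remove T x))
size-remove T x x∈T = begin
    size T
  ≡⟨ sumFin-cong (λ y → 𝟙-remove-count (T y) (is-x y)) ⟩
    sumFin (λ y → 𝟙 (remove T x y) + 𝟙 (is-x y) * 𝟙 (T y))
  ≡⟨ sumFin-distrib-+ (𝟙 ∘ remove T x) (λ y → 𝟙 (is-x y) * 𝟙 (T y)) ⟩
    size (remove T x) + sumFin (λ y → 𝟙 (is-x y) * 𝟙 (T y))
  ≡⟨ cong (size (remove T x) +_) (trans (sumFin-δ x (𝟙 ∘ T)) (cong 𝟙 x∈T)) ⟩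
    size (remove T x) + 1
  ≡⟨ +-comm _ 1 ⟩
    suc (size (remove T x)) ∎
  where
  open ≡-Reasoning
  is-x = λ y → does (y F.≟ x)

-- An edge yz of G[T] is either an edge of G[T − x], or has y = x, or has z = x.
𝟙-remove-split : ∀ ty tz ey ez a → 𝟙 ty * (𝟙 tz * 𝟙 a) ≤
  𝟙 (ty ∧ not ey) * (𝟙 (tz ∧ not ez) * 𝟙 a) + 𝟙 ey * (𝟙 tz * 𝟙 a) + 𝟙 ez * (𝟙 ty * 𝟙 a)
𝟙-remove-split false _     _     _     _     = z≤n
𝟙-remove-split true  false _     _     _     = z≤n
𝟙-remove-split true  true  _     _     false = z≤n
𝟙-remove-split true  true  false false true  = s≤s z≤n
𝟙-remove-split true  true  false true  true  = s≤s z≤n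
𝟙-remove-split true  true  true  _     true  = s≤s z≤n

module _ {n} (G : Graph n) where

  degreeSum : Subset n → ℕ
  degreeSum T = sumFin λ x → 𝟙 (T x) * inducedDeg G T x

  degreeSum≡edgePairs : ∀ T → degreeSum T ≡ sumFin λ x → sumFin λ y → 𝟙 (T x) * (𝟙 (T y) * 𝟙 (adj G x y))
  degreeSum≡edgePairs T = sumFin-cong λ x → trans (sym (sumFin-*ˡ (𝟙 (T x)) (λ y → 𝟙 (T y ∧ adj G x y))))
    (sumFin-cong λ y → cong (𝟙 (T x) *_) (𝟙-∧ (T y) (adj G x y)))

  degreeSum-remove : ∀ T x → degreeSum T ≤ degreeSum (remove T x) + 2 * inducedDeg G T x
  degreeSum-remove T x = begin
      degreeSum T
    ≡⟨ degreeSum≡edgePairs T ⟩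
      sumFin (λ y → sumFin λ z → 𝟙 (T y) * (𝟙 (T z) * 𝟙 (adj G y z)))
    ≤⟨ sumFin-mono-≤ (λ y → sumFin-mono-≤ λ z → 𝟙-remove-split (T y) (T z) (is-x y) (is-x z) (adj G y z)) ⟩
      sumFin (λ y → sumFin λ z → kept y z + atˡ y z + atʳ y z)
    ≡⟨ trans (sumFin²-distrib-+ (λ y z → kept y z + atˡ y z) atʳ)
             (cong (_+ sumFin (λ y → sumFin (atʳ y))) (sumFin²-distrib-+ kept atˡ)) ⟩
      sumFin (λ y → sumFin (kept y)) + sumFin (λ y → sumFin (atˡ y)) + sumFin (λ y → sumFin (atʳ y))
    ≡⟨ cong₂ _+_ (cong₂ _+_ (sym (degreeSum≡edgePairs (remove T x))) atˡ-sum) atʳ-sum ⟩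
      degreeSum (remove T x) + d + d
    ≡⟨ +-assoc (degreeSum (remove T x)) d d ⟩
      degreeSum (remove T x) + (d + d)
    ≡⟨ cong (λ e → degreeSum (remove T x) + (d + e)) (+-identityʳ d) ⟨
      degreeSum (remove T x) + 2 * d ∎
    where
    open ≤-Reasoning
    is-x = λ y → does (y F.≟ x)
    d = inducedDeg G T x
    kept atˡ atʳ : Fin n → Fin n → ℕ
    kept y z = 𝟙 (remove T x y) * (𝟙 (remove T x z) * 𝟙 (adj G y z))
    atˡ  y z = 𝟙 (is-x y) * (𝟙 (T z) * 𝟙 (adj G y z))
    atʳ  y z = 𝟙 (is-x z) * (𝟙 (T y) * 𝟙 (adj G y z))

    atˡ-sum : sumFin (λ y → sumFin (atˡ y)) ≡ d
    atˡ-sum = begin-equality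
        sumFin (λ y → sumFin (atˡ y))
      ≡⟨ sumFin-cong (λ y → sumFin-*ˡ (𝟙 (is-x y)) (λ z → 𝟙 (T z) * 𝟙 (adj G y z))) ⟩
        sumFin (λ y → 𝟙 (is-x y) * sumFin (λ z → 𝟙 (T z) * 𝟙 (adj G y z)))
      ≡⟨ sumFin-δ x (λ y → sumFin (λ z → 𝟙 (T z) * 𝟙 (adj G y z))) ⟩
        sumFin (λ z → 𝟙 (T z) * 𝟙 (adj G x z))
      ≡⟨ sumFin-cong (λ z → 𝟙-∧ (T z) (adj G x z)) ⟨
        d ∎

    atʳ-sum : sumFin (λ y → sumFin (atʳ y)) ≡ d
    atʳ-sum = begin-equality
        sumFin (λ y → sumFin (atʳ y))
      ≡⟨ sumFin-cong (λ y → sumFin-δ x (λ z → 𝟙 (T y) * 𝟙 (adj G y z))) ⟩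
        sumFin (λ y → 𝟙 (T y) * 𝟙 (adj G y x))
      ≡⟨ sumFin-cong (λ y → trans (cong (λ b → 𝟙 (T y) * 𝟙 b) (adj-sym G y x)) (sym (𝟙-∧ (T y) (adj G x y)))) ⟩
        d ∎

  private
    dense-remove : ∀ W K T x → x ∈S T → K * inducedDeg G T x < W →
      2 * W * size T ≤ K * degreeSum T → 2 * W * size (remove T x) < K * degreeSum (remove T x)
    dense-remove W K T x x∈T low dense = +-cancelʳ-< (2 * W) _ _ (begin-strict
        2 * W * s' + 2 * W          ≡⟨ +-comm _ (2 * W) ⟩
        2 * W + 2 * W * s'          ≡⟨ *-suc (2 * W) s' ⟨
        2 * W * suc s'              ≡⟨ cong (2 * W *_) (size-remove T x x∈T) ⟨
        2 * W * size T              ≤⟨ dense ⟩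
        K * degreeSum T             ≤⟨ *-monoʳ-≤ K (degreeSum-remove T x) ⟩
        K * (D' + 2 * d)            ≡⟨ distrib K D' d ⟩
        K * D' + 2 * (K * d)        <⟨ +-monoʳ-< (K * D') (*-monoʳ-< 2 low) ⟩
        K * D' + 2 * W              ∎)
      where
      open ≤-Reasoning
      s' = size (remove T x)
      D' = degreeSum (remove T x)
      d = inducedDeg G T x
      distrib : ∀ K D d → K * (D + 2 * d) ≡ K * D + 2 * (K * d)
      distrib = solve-∀

    degreeSum>0⇒nonempty : ∀ T → 0 < degreeSum T → Nonempty T
    degreeSum>0⇒nonempty T pos with sumFin>0⇒term>0 (λ x → 𝟙 (T x) * inducedDeg G T x) pos
    ... | x , term>0 = x , 𝟙*>0⇒≡true (T x) term>0

  MinDegreeWithin : ℕ → ℕ → Subset n → Set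
  MinDegreeWithin W K T = Σ (Subset n) λ S → S ⊆S T × Nonempty S ×
    ((v : Fin n) → v ∈S S → W ≤ K * inducedDeg G S v)

  -- Deleting a vertex of degree below W/K keeps the average degree above 2W/K,
  -- so the deletion process stops at a nonempty subgraph of minimum degree at least W/K.
  dense⇒minDegree : ∀ W K T → 2 * W * size T ≤ K * degreeSum T → 0 < degreeSum T → MinDegreeWithin W K T
  dense⇒minDegree W K T = peel (size T) T ≤-refl
    where
    peel : ∀ fuel T → size T ≤ fuel → 2 * W * size T ≤ K * degreeSum T → 0 < degreeSum T → MinDegreeWithin W K T
    peel fuel T size≤fuel dense pos with any? (λ x → (T x Bool.≟ true) ×-dec (K * inducedDeg G T x <? W))
    ... | no none = T , (λ _ v∈T → v∈T) , degreeSum>0⇒nonempty T pos ,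
                    λ v v∈T → ≮⇒≥ λ low → none (v , v∈T , low)
    peel zero T size≤0 _ _ | yes (x , x∈T , _) = contradiction (subst (_≤ 0) (size-remove T x x∈T) size≤0) λ ()
    peel (suc fuel) T size≤fuel dense _ | yes (x , x∈T , low)
      with peel fuel (remove T x) (s≤s⁻¹ (subst (_≤ suc fuel) (size-remove T x x∈T) size≤fuel))
                (<⇒≤ dense') (0<m*n⇒0<n K (m<n⇒0<n dense'))
      where dense' = dense-remove W K T x x∈T low dense
    ... | S , S⊆T' , rest = S , (λ v v∈S → ∧≡true⇒ˡ (S⊆T' v v∈S)) , rest

InducedBipartite-⊆ : ∀ {n} (G : Graph n) {S T : Subset n} → S ⊆S T → InducedBipartite G T → InducedBipartite G S
InducedBipartite-⊆ G S⊆T (colour , proper) =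
  colour , λ u v u∈S v∈S u~v → proper u v (S⊆T u u∈S) (S⊆T v v∈S) u~v

neighbourhoodΔ : ∀ {n} → Graph n → Fin n → Fin n → Subset n
neighbourhoodΔ G u w x = adj G u x xor adj G w x

-- Read p q r as u~x, x~y, y~w and s t as w~x, y~u: once the triangles uxy and wxy are excluded,
-- a walk u x y w or w x y u runs through an edge xy with both ends in N(u) Δ N(w).
𝟙-walks-through-≤ : ∀ p q r s t → p ∧ q ∧ t ≡ false → s ∧ q ∧ r ≡ false →
  𝟙 p * 𝟙 q * 𝟙 r + 𝟙 s * 𝟙 q * 𝟙 t ≤ 𝟙 (p xor s) * (𝟙 (t xor r) * 𝟙 q)
𝟙-walks-through-≤ false _     _     false _     _  _  = z≤n
𝟙-walks-through-≤ true  false _     true  _     _  _  = z≤n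
𝟙-walks-through-≤ true  true  false true  false _  _  = z≤n
𝟙-walks-through-≤ true  true  _     true  true  () _
𝟙-walks-through-≤ true  true  true  true  false _  ()
𝟙-walks-through-≤ true  false _     false _     _  _  = z≤n
𝟙-walks-through-≤ true  true  _     false true  () _
𝟙-walks-through-≤ true  true  false false false _  _  = z≤n
𝟙-walks-through-≤ true  true  true  false false _  _  = s≤s z≤n
𝟙-walks-through-≤ false false _     true  _     _  _  = z≤n
𝟙-walks-through-≤ false true  true  true  _     _  ()
𝟙-walks-through-≤ false true  false true  false _  _  = z≤n
𝟙-walks-through-≤ false true  false true  true  _  _  = s≤s z≤n

module _ {n} (G : Graph n) (triangle-free : TriangleFree G) where

  triangleFree-cyclic : ∀ u v w → adj G u v ∧ adj G v w ∧ adj G w u ≡ false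
  triangleFree-cyclic u v w with adj G u v in u~v | adj G v w in v~w | adj G w u in w~u
  ... | true  | true  | true  = contradiction (u~v , v~w , trans (adj-sym G u w) w~u) (triangle-free u v w)
  ... | true  | true  | false = refl
  ... | true  | false | _     = refl
  ... | false | _     | _     = refl

  Δ-bipartite : ∀ u w → InducedBipartite G (neighbourhoodΔ G u w)
  Δ-bipartite u w = adj G u , proper
    where
    proper : ∀ x y → x ∈S neighbourhoodΔ G u w → y ∈S neighbourhoodΔ G u w →
      adj G x y ≡ true → adj G u x ≢ adj G u y
    proper x y x∈Δ y∈Δ x~y same with adj G u x in u~x | adj G u y in u~y
    ... | true  | true  = triangle-free u x y (u~x , x~y , u~y)
    ... | false | false = triangle-free w x y (x∈Δ , x~y , y∈Δ)

  Δ-size-≤ : ∀ u w → size (neighbourhoodΔ G u w) ≤ deg G u + deg G w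
  Δ-size-≤ u w = ≤-trans (sumFin-mono-≤ λ x → 𝟙-xor-≤ (adj G u x) (adj G w x))
                         (≤-reflexive (sumFin-distrib-+ (λ x → 𝟙 (adj G u x)) (λ x → 𝟙 (adj G w x))))

  walksBetween-≤-Δ-degreeSum : ∀ u w →
    walksBetween G u w + walksBetween G w u ≤ degreeSum G (neighbourhoodΔ G u w)
  walksBetween-≤-Δ-degreeSum u w = begin
      walksBetween G u w + walksBetween G w u
    ≡⟨ sumFin²-distrib-+ walk-uw walk-wu ⟨
      sumFin (λ x → sumFin λ y → walk-uw x y + walk-wu x y)
    ≤⟨ sumFin-mono-≤ (λ x → sumFin-mono-≤ (through x)) ⟩
      sumFin (λ x → sumFin λ y → 𝟙 (Δ x) * (𝟙 (Δ y) * 𝟙 (adj G x y)))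
    ≡⟨ degreeSum≡edgePairs G Δ ⟨
      degreeSum G Δ ∎
    where
    open ≤-Reasoning
    Δ = neighbourhoodΔ G u w
    walk-uw walk-wu : Fin n → Fin n → ℕ
    walk-uw x y = 𝟙 (adj G u x) * 𝟙 (adj G x y) * 𝟙 (adj G y w)
    walk-wu x y = 𝟙 (adj G w x) * 𝟙 (adj G x y) * 𝟙 (adj G y u)
    through : ∀ x y → walk-uw x y + walk-wu x y ≤ 𝟙 (Δ x) * (𝟙 (Δ y) * 𝟙 (adj G x y))
    through x y = subst (λ b → walk-uw x y + walk-wu x y ≤ 𝟙 (Δ x) * (𝟙 b * 𝟙 (adj G x y)))
      (cong₂ _xor_ (adj-sym G y u) (adj-sym G y w))
      (𝟙-walks-through-≤ (adj G u x) (adj G x y) (adj G y w) (adj G w x) (adj G y u)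
        (triangleFree-cyclic u x y) (triangleFree-cyclic w x y))

  Δ-dense : ∀ W K u w → W * (deg G u + deg G w) ≤ K * walksBetween G u w →
    2 * W * size (neighbourhoodΔ G u w) ≤ K * degreeSum G (neighbourhoodΔ G u w)
  Δ-dense W K u w heavy = begin
      2 * W * size Δ                 ≤⟨ *-monoʳ-≤ (2 * W) (Δ-size-≤ u w) ⟩
      2 * W * (deg G u + deg G w)    ≡⟨ *-assoc 2 W _ ⟩
      2 * (W * (deg G u + deg G w))  ≤⟨ *-monoʳ-≤ 2 heavy ⟩
      2 * (K * p)                    ≡⟨ double K p ⟩
      K * (p + p)                    ≡⟨ cong (λ q → K * (p + q)) (walksBetween-sym G u w) ⟨
      K * (p + walksBetween G w u)   ≤⟨ *-monoʳ-≤ K (walksBetween-≤-Δ-degreeSum u w) ⟩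
      K * degreeSum G Δ              ∎
    where
    open ≤-Reasoning
    Δ = neighbourhoodΔ G u w
    p = walksBetween G u w
    double : ∀ K p → 2 * (K * p) ≡ K * (p + p)
    double = solve-∀

  Δ-degreeSum>0 : ∀ u w → 0 < walksBetween G u w → 0 < degreeSum G (neighbourhoodΔ G u w)
  Δ-degreeSum>0 u w p>0 = <-≤-trans (<-≤-trans p>0 (m≤m+n _ _)) (walksBetween-≤-Δ-degreeSum u w)

theorem1p5 : (n : ℕ) → 2 ≤ n → (G : Graph n) → TriangleFree G → 1 ≤ edgeCount G →
    Σ (Subset n) λ S → Nonempty S × InducedBipartite G S ×
      ((v : Fin n) → v ∈S S → walks3 G ≤ 4 * n * edgeCount G * inducedDeg G S v)
theorem1p5 n _ G triangle-free m>0 =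
  let W = walks3 G
      K = 4 * n * edgeCount G
      (u , w , heavy , p>0) = ∃-heavy-pair G (walks3>0 G m>0)
      (S , S⊆Δ , S≠∅ , minDegree) = dense⇒minDegree G W K (neighbourhoodΔ G u w)
        (Δ-dense G triangle-free W K u w heavy) (Δ-degreeSum>0 G triangle-free u w p>0)
  in S , S≠∅ , InducedBipartite-⊆ G S⊆Δ (Δ-bipartite G triangle-free u w) , minDegree
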